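{- A sequence $\alpha:\mathbb N\to\mathbb Z$ is an absolute stabilizer if and only if it represents an integer polyadic number, i.e. if and only if there is $m\in\mathbb Z$ such that the sequence $(\alpha_k-m)_k$ belongs to $\mathscr C_0$.
   Context: $\mathscr A$ denotes the set of all complex-valued periodic functions on $\mathbb Z$. A sequence $\alpha:\mathbb N\to\mathbb Z$ stabilizes $u:\mathbb Z\to\mathbb C$ at the final value $(u\circ\alpha)_\infty=v$ if $u(\alpha_n)=v$ for all but finitely many $n$; $\alpha$ is a stabilizer if it stabilizes every $u\in\mathscr A$; a stabilizer $\alpha$ is absolute if there is an integer $n$ such that $(u\circ\alpha)_\infty=u(n)$ for all $u\in\mathscr A$. $\mathscr C_0$ is the set of integer sequences $\beta$ such that for every positive integer $n$, $\beta_k\equiv0\pmod n$ for all but finitely many $k$. An integer polyadic number with value $m$ is the class modulo $\mathscr C_0$ of the constant sequence $m$. -}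

module Defs where

open import Data.Nat using (ℕ; _≤_)
open import Data.Integer using (ℤ; +_; _+_; _-_; _<_)
open import Data.Integer.Divisibility using (_∣_)
open import Data.Product using (Σ; ∃; _×_)
open import Relation.Binary.PropositionalEquality using (_≡_)

-- The codomain ℂ is not available in agda-stdlib; the notions below are
-- parametrised by an arbitrary codomain type C.

Periodic : {C : Set} → (ℤ → C) → Set
Periodic u = ∃ λ (p : ℤ) → (+ 0 < p) × (∀ x → u (x + p) ≡ u x)

StabilizesAt : {C : Set} → (ℤ → C) → (ℕ → ℤ) → C → Set
StabilizesAt u α v = ∃ λ (N : ℕ) → ∀ n → N ≤ n → u (α n) ≡ v

Stabilizer : (C : Set) → (ℕ → ℤ) → Set
Stabilizer C α = (u : ℤ → C) → Periodic u → ∃ λ (v : C) → StabilizesAt u α v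

-- Absolute stabilizer: a stabilizer for which there is an integer n with
-- (u ∘ α)_∞ = u n for every periodic u (final values are unique).
AbsoluteStabilizer : (C : Set) → (ℕ → ℤ) → Set
AbsoluteStabilizer C α =
  Stabilizer C α ×
  ∃ λ (n : ℤ) → (u : ℤ → C) → Periodic u → StabilizesAt u α (u n)

C₀ : (ℕ → ℤ) → Set
C₀ β = (n : ℤ) → + 0 < n → ∃ λ (K : ℕ) → ∀ k → K ≤ k → n ∣ β k

module Submission where

-- The proof rests on two facts about periodic functions u : ℤ → C.
--   * A function with period p is constant on residue classes modulo p
--     (`congruent⇒equal`).  Hence if d ∣ αₖ - m eventually for every d,
--     then u (αₖ) = u m eventually for every periodic u: α is an absolute
--     stabilizer with final value u m.
--   * For d > 0 and a centre n, the indicator of the residue class of n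
--     modulo d (value c₀ on it, c₁ ≠ c₀ off it) is periodic with period d.
--     If α stabilizes it at its value at n, then eventually αₖ lies in that
--     class, i.e. d ∣ αₖ - n; so α - n ∈ 𝒞₀.
-- Only two distinct values of C are needed, which is why the theorem holds
-- for any codomain containing c₀ ≢ c₁.

open import Defs
open import Data.Nat using (ℕ; zero; suc; _≤_)
open import Data.Integer using (ℤ; _-_; +_; -[1+_]; _+_; _*_; -_)
import Data.Integer.Divisibility as Unsigned
open import Data.Integer.Divisibility.Signed
  using (_∣_; divides; ∣ᵤ⇒∣; ∣⇒∣ᵤ; _∣?_; ∣-refl; ∣-trans; ∣-reflexive; ∣m∣n⇒∣m+n; ∣m+n∣n⇒∣m)
open import Data.Integer.Tactic.RingSolver using (solve-∀)
open import Data.Product using (∃; _,_)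
open import Function.Bundles using (_⇔_; mk⇔)
open import Relation.Binary.PropositionalEquality using (_≢_; _≡_; refl; sym; trans; cong)
open import Relation.Nullary using (yes; no; contradiction)

module PeriodMultiples {C : Set} (u : ℤ → C) (p : ℤ)
                       (period : ∀ x → u (x + p) ≡ u x) where

  shift-ℕ-multiple : ∀ j x → u (x + + j * p) ≡ u x
  shift-ℕ-multiple zero    x = cong u (drop-zero x p)
    where drop-zero : ∀ x p → x + + 0 * p ≡ x
          drop-zero = solve-∀
  shift-ℕ-multiple (suc j) x =
    trans (cong u (peel x (+ j) p))
          (trans (period (x + + j * p)) (shift-ℕ-multiple j x))
    where peel : ∀ x j p → x + (+ 1 + j) * p ≡ (x + j * p) + p
          peel = solve-∀

  -- Negative multiples reduce to positive ones: x = (x + q p) + (-q) p.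
  shift-multiple : ∀ q x → u (x + q * p) ≡ u x
  shift-multiple (+ j)    x = shift-ℕ-multiple j x
  shift-multiple -[1+ j ] x =
    trans (sym (shift-ℕ-multiple (suc j) (x + -[1+ j ] * p)))
          (cong u (cancel x -[1+ j ] p))
    where cancel : ∀ x q p → (x + q * p) + (- q) * p ≡ x
          cancel = solve-∀

  congruent⇒equal : ∀ {x y} → p ∣ (y - x) → u y ≡ u x
  congruent⇒equal {x} {y} (divides q y-x≡qp) =
    trans (cong u y≡x+qp) (shift-multiple q x)
    where
      add-back : ∀ x y → x + (y - x) ≡ y
      add-back = solve-∀
      y≡x+qp : y ≡ x + q * p
      y≡x+qp = trans (sym (add-back x y)) (cong (λ z → x + z) y-x≡qp)

∣-shift⇒∣ : ∀ {d a} → d ∣ (a + d) → d ∣ a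
∣-shift⇒∣ d∣a+d = ∣m+n∣n⇒∣m d∣a+d ∣-refl

∣⇒∣-shift : ∀ {d a} → d ∣ a → d ∣ (a + d)
∣⇒∣-shift d∣a = ∣m∣n⇒∣m+n d∣a ∣-refl

module ResidueIndicator {C : Set} (c₀ c₁ : C) (d n : ℤ) where

  indicator : ℤ → C
  indicator x with d ∣? (x - n)
  ... | yes _ = c₀
  ... | no  _ = c₁

  regroup : ∀ x n d → x + d - n ≡ (x - n) + d
  regroup = solve-∀

  indicator-periodic : ∀ x → indicator (x + d) ≡ indicator x
  indicator-periodic x with d ∣? (x + d - n) | d ∣? (x - n)
  ... | yes _ | yes _ = refl
  ... | no  _ | no  _ = refl
  ... | yes in-class | no not-in =
    contradiction (∣-shift⇒∣ (∣-trans in-class (∣-reflexive (regroup x n d)))) not-in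
  ... | no not-in | yes in-class =
    contradiction (∣-trans (∣⇒∣-shift in-class) (∣-reflexive (sym (regroup x n d)))) not-in

  indicator-centre : indicator n ≡ c₀
  indicator-centre with d ∣? (n - n)
  ... | yes _ = refl
  ... | no not-in = contradiction (divides (+ 0) (self-diff n d)) not-in
    where self-diff : ∀ n d → n - n ≡ + 0 * d
          self-diff = solve-∀

  indicator⇒∣ : c₀ ≢ c₁ → ∀ x → indicator x ≡ c₀ → d ∣ (x - n)
  indicator⇒∣ c₀≢c₁ x _  with d ∣? (x - n)
  indicator⇒∣ c₀≢c₁ x _  | yes in-class = in-class
  indicator⇒∣ c₀≢c₁ x c₁≡c₀ | no _ = contradiction (sym c₁≡c₀) c₀≢c₁

polyadic⇒stabilizes : {C : Set} (α : ℕ → ℤ) (m : ℤ) → C₀ (λ k → α k - m) →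
  (u : ℤ → C) → Periodic u → StabilizesAt u α (u m)
polyadic⇒stabilizes α m α≡m u (p , p>0 , period) with α≡m p p>0
... | K , eventually-divisible =
  K , λ k K≤k → congruent⇒equal (∣ᵤ⇒∣ (eventually-divisible k K≤k))
  where open PeriodMultiples u p period

-- Necessity: if α stabilizes every periodic function u at u n, then
-- α - n ∈ 𝒞₀; test α against the indicator of n's residue class mod d.
stabilizes⇒polyadic : {C : Set} (c₀ c₁ : C) → c₀ ≢ c₁ → (α : ℕ → ℤ) (n : ℤ) →
  ((u : ℤ → C) → Periodic u → StabilizesAt u α (u n)) → C₀ (λ k → α k - n)
stabilizes⇒polyadic c₀ c₁ c₀≢c₁ α n stabilizes d d>0 =
  eventually-in-class (stabilizes indicator (d , d>0 , indicator-periodic))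
  where
  open ResidueIndicator c₀ c₁ d n
  eventually-in-class : StabilizesAt indicator α (indicator n) →
    ∃ λ K → ∀ k → K ≤ k → d Unsigned.∣ (α k - n)
  eventually-in-class (K , eventually-centre) =
    K , λ k K≤k → ∣⇒∣ᵤ (indicator⇒∣ c₀≢c₁ (α k)
                          (trans (eventually-centre k K≤k) indicator-centre))

mainTheorem15 : {C : Set} (c₀ c₁ : C) → c₀ ≢ c₁ → (α : ℕ → ℤ) →
    AbsoluteStabilizer C α ⇔ (∃ λ (m : ℤ) → C₀ (λ k → α k - m))
mainTheorem15 c₀ c₁ c₀≢c₁ α = mk⇔ absolute⇒polyadic polyadic⇒absolute
  where
  absolute⇒polyadic : AbsoluteStabilizer _ α → ∃ λ m → C₀ (λ k → α k - m)
  absolute⇒polyadic (_ , n , stabilizes) =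
    n , stabilizes⇒polyadic c₀ c₁ c₀≢c₁ α n stabilizes

  polyadic⇒absolute : (∃ λ m → C₀ (λ k → α k - m)) → AbsoluteStabilizer _ α
  polyadic⇒absolute (m , α≡m) =
    (λ u periodic → u m , polyadic⇒stabilizes α m α≡m u periodic) ,
    m , polyadic⇒stabilizes α m α≡m
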